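{- For $n\ge 3$, $mag^-(C_n)=2$, and $mag^+(C_3)=3$. For $n\ge 4$, $mag^+(C_n)=n-1$ if $n$ is odd and $mag^+(C_n)=n$ if $n$ is even.
   Context: $C_n$ is the cycle of length $n$. For an oriented graph $\vec G$, two distinct vertices $x,y$ monitor an arc $a$ if $a$ lies on every shortest directed path from $x$ to $y$, or on every shortest directed path from $y$ to $x$. A monitoring arc-geodetic set (MAG-set) is a vertex set $M$ such that every arc is monitored by some pair of distinct vertices of $M$; $mag(\vec G)$ is its minimum size. For an undirected graph $G$, $mag^-(G)$ and $mag^+(G)$ are the minimum and maximum of $mag(\vec G)$ over all orientations $\vec G$ of $G$. -}

module Defs where

open import Data.Nat using (ℕ; zero; suc; _≤_; _<_)
open import Data.Nat.DivMod using (_mod_)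
open import Data.Fin using (Fin; toℕ)
open import Data.Fin.Subset using (Subset; _∈_; ∣_∣)
open import Data.Bool using (Bool; true; false; if_then_else_)
open import Data.Product using (Σ; _×_; ∃; ∃-syntax; _,_)
open import Data.Sum using (_⊎_)
open import Relation.Binary.PropositionalEquality using (_≡_; _≢_)
open import Relation.Nullary using (¬_)

-- The cycle C_n: vertex set Fin n, and for each i : Fin n an edge
-- (edge number i) joining i and i+1 (mod n).
next : ∀ {n} → Fin n → Fin n
next {zero} ()
next {suc m} i = suc (toℕ i) mod suc m

-- An orientation of C_n: for every edge i, true means the arc i → i+1,
-- false means the arc i+1 → i.
Orientation : ℕ → Set
Orientation n = Fin n → Bool

tail : ∀ {n} → Orientation n → Fin n → Fin n
tail o e = if o e then e else next e

head : ∀ {n} → Orientation n → Fin n → Fin n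
head o e = if o e then next e else e

data Walk {n : ℕ} (o : Orientation n) : Fin n → Fin n → ℕ → Set where
  nil  : ∀ {x} → Walk o x x 0
  cons : ∀ {x y k} (e : Fin n) → tail o e ≡ x → Walk o (head o e) y k →
         Walk o x y (suc k)

data OnWalk {n : ℕ} {o : Orientation n} (e : Fin n) :
            ∀ {x y k} → Walk o x y k → Set where
  here  : ∀ {x y k} (p : tail o e ≡ x) (w : Walk o (head o e) y k) →
          OnWalk e (cons e p w)
  there : ∀ {x y k} (f : Fin n) (p : tail o f ≡ x) (w : Walk o (head o f) y k) →
          OnWalk e w → OnWalk e (cons f p w)

Dist : ∀ {n} → Orientation n → Fin n → Fin n → ℕ → Set
Dist o x y k = Walk o x y k × (∀ j → j < k → ¬ Walk o x y j)

-- x,y monitor arc e in direction x → y: some shortest directed x–y path exists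
-- and e lies on every shortest directed x–y path.
-- (Shortest directed walks are automatically paths.)
MonitorsDir : ∀ {n} → Orientation n → Fin n → Fin n → Fin n → Set
MonitorsDir o x y e =
  Σ ℕ λ k → Dist o x y k × ((w : Walk o x y k) → OnWalk e w)

Monitors : ∀ {n} → Orientation n → Fin n → Fin n → Fin n → Set
Monitors o x y e = MonitorsDir o x y e ⊎ MonitorsDir o y x e

IsMAG : ∀ {n} → Orientation n → Subset n → Set
IsMAG {n} o M = (e : Fin n) →
  ∃[ x ] ∃[ y ] (x ∈ M × y ∈ M × x ≢ y × Monitors o x y e)

IsMag : ∀ {n} → Orientation n → ℕ → Set
IsMag {n} o m =
  (∃[ M ] (IsMAG o M × ∣ M ∣ ≡ m)) × ((M : Subset n) → IsMAG o M → m ≤ ∣ M ∣)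

MagMinus : ℕ → ℕ → Set
MagMinus n m =
  (∃[ o ] IsMag {n} o m) × ((o : Orientation n) (k : ℕ) → IsMag o k → m ≤ k)

MagPlus : ℕ → ℕ → Set
MagPlus n m =
  (∃[ o ] IsMag {n} o m) × ((o : Orientation n) (k : ℕ) → IsMag o k → k ≤ m)

-- Every arc is the unique shortest path from its tail to its head (n ≥ 3), so the whole vertex
-- set is a MAG-set, while monitoring anything takes two vertices. In the directed cycle the long
-- way round from 1 to 0 is the only shortest 1–0 path, so {0, 1} suffices. If consecutive arcs
-- e, e+1 point the same way, which every orientation of an odd cycle has, then for n ≥ 5 the
-- path e, e+1 is the only shortest path between its ends, so the middle vertex can be dropped.
-- Conversely, an arc from a source to a sink lies on no walk but itself, so both its ends belong
-- to every MAG-set. In the alternating orientation every vertex is an end of such an arc, except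
-- vertex 0 when n is odd; for n = 3 vertex 0 is still forced, because the remaining pair {1, 2}
-- does not monitor the arc 0 → 1.
module Submission where

open import Data.Bool using (Bool; true; false; not; if_then_else_)
open import Data.Bool.Properties using (not-involutive; not-¬; ¬-not) renaming (_≟_ to _≟ᵇ_)
open import Data.Empty using (⊥-elim)
open import Data.Fin using (Fin; toℕ; _≟_) renaming (zero to fzero; suc to fsuc)
open import Data.Fin.Properties using (toℕ-fromℕ<; toℕ<n; toℕ-injective; any?)
open import Data.Fin.Subset using (Subset; _∈_; ∣_∣; ⊤; ⊥; ∁; ⁅_⁆; inside)
open import Data.Fin.Subset.Properties
  using (∈⊤; ∣⊤∣≡n; ∣⊥∣≡0; ∣⁅x⁆∣≡1; ∣∁p∣≡n∸∣p∣; x∈⁅y⁆⇒x≡y; x≢y⇒x∉⁅y⁆; x∉⁅y⁆⇒x≢y;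
         x∈∁p⇒x∉p; x∉p⇒x∈∁p; x∈p∧x≢y⇒x∈p-y; x∈p⇒∣p-x∣<∣p∣; p⊆q⇒∣p∣≤∣q∣)
open import Data.Nat using (ℕ; zero; suc; _+_; _*_; _∸_; _%_; _/_; _≡ᵇ_; _≤_; _<_;
                            s≤s; z<s; s<s; NonZero; >-nonZero)
open import Data.Nat.DivMod
  using (m≡m%n+[m/n]*n; m%n<n; m<n⇒m%n≡m; n%n≡0; [m+n]%n≡m%n; %-distribˡ-+; m%n%n≡m%n)
open import Data.Nat.Divisibility using (divides; >⇒∤)
open import Data.Nat.GeneralisedArithmetic using (iterate)
open import Data.Nat.Properties
  using (+-identityʳ; +-suc; +-cancelˡ-≡; ≤-trans; ≤-reflexive; ≤-antisym; n≤1+n;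
         m≤n⇒m<n∨m≡n)
open import Data.Product using (_×_; ∃-syntax; _,_; proj₁; proj₂)
open import Data.Sum using (_⊎_; inj₁; inj₂; swap)
open import Data.Vec using (_∷_; here; there)
open import Function using (_∘_; case_of_)
open import Relation.Binary.PropositionalEquality
open import Relation.Nullary using (¬_; yes; no)

open import Defs

private
  variable
    m n k : ℕ

[a%d+b]%d≡[a+b]%d : ∀ a b d .{{_ : NonZero d}} → (a % d + b) % d ≡ (a + b) % d
[a%d+b]%d≡[a+b]%d a b d = begin
  (a % d + b) % d          ≡⟨ %-distribˡ-+ (a % d) b d ⟩
  (a % d % d + b % d) % d  ≡⟨ cong (λ r → (r + b % d) % d) (m%n%n≡m%n a d) ⟩
  (a % d + b % d) % d      ≡⟨ %-distribˡ-+ a b d ⟨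
  (a + b) % d              ∎
  where open ≡-Reasoning

iterate-shift : ∀ {a} {A : Set a} (f : A → A) x k → iterate f (f x) k ≡ f (iterate f x k)
iterate-shift f x zero    = refl
iterate-shift f x (suc k) = iterate-shift f (f x) k

toℕ-next : (x : Fin (suc m)) → toℕ (next x) ≡ suc (toℕ x) % suc m
toℕ-next {m} x = toℕ-fromℕ< (m%n<n (suc (toℕ x)) (suc m))

toℕ-next-cases : (x : Fin (suc m)) →
                 toℕ (next x) ≡ suc (toℕ x) ⊎ (toℕ (next x) ≡ 0 × suc (toℕ x) ≡ suc m)
toℕ-next-cases {m} x with m≤n⇒m<n∨m≡n (toℕ<n x)
... | inj₁ x+1<n = inj₁ (trans (toℕ-next x) (m<n⇒m%n≡m x+1<n))
... | inj₂ x+1≡n =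
  inj₂ (trans (toℕ-next x) (trans (cong (_% suc m) x+1≡n) (n%n≡0 (suc m))) , x+1≡n)

toℕ-iterate-next : ∀ k (x : Fin (suc m)) → toℕ (iterate next x k) ≡ (toℕ x + k) % suc m
toℕ-iterate-next {m} zero x =
  sym (trans (cong (_% suc m) (+-identityʳ (toℕ x))) (m<n⇒m%n≡m (toℕ<n x)))
toℕ-iterate-next {m} (suc k) x = begin
  toℕ (iterate next (next x) k)       ≡⟨ toℕ-iterate-next k (next x) ⟩
  (toℕ (next x) + k) % suc m          ≡⟨ cong (λ a → (a + k) % suc m) (toℕ-next x) ⟩
  (suc (toℕ x) % suc m + k) % suc m   ≡⟨ [a%d+b]%d≡[a+b]%d (suc (toℕ x)) k (suc m) ⟩
  (suc (toℕ x) + k) % suc m           ≡⟨ cong (_% suc m) (+-suc (toℕ x) k) ⟨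
  (toℕ x + suc k) % suc m             ∎
  where open ≡-Reasoning

iterate-next-period : (x : Fin (suc m)) → iterate next x (suc m) ≡ x
iterate-next-period {m} x = toℕ-injective (begin
  toℕ (iterate next x (suc m))  ≡⟨ toℕ-iterate-next (suc m) x ⟩
  (toℕ x + suc m) % suc m       ≡⟨ [m+n]%n≡m%n (toℕ x) (suc m) ⟩
  toℕ x % suc m                 ≡⟨ m<n⇒m%n≡m (toℕ<n x) ⟩
  toℕ x                         ∎)
  where open ≡-Reasoning

iterate-next-from-0 : (x : Fin (suc m)) → iterate next fzero (toℕ x) ≡ x
iterate-next-from-0 x =
  toℕ-injective (trans (toℕ-iterate-next (toℕ x) fzero) (m<n⇒m%n≡m (toℕ<n x)))

-- A return to x after k steps makes k a multiple of n.
iterate-next≢id : (x : Fin (suc m)) → 0 < k → k < suc m → iterate next x k ≢ x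
iterate-next≢id {m} {k} x 0<k k<n eq = >⇒∤ {{>-nonZero 0<k}} k<n (divides q k≡q*n)
  where
  open ≡-Reasoning
  q : ℕ
  q = (toℕ x + k) / suc m
  k≡q*n : k ≡ q * suc m
  k≡q*n = +-cancelˡ-≡ (toℕ x) k (q * suc m) (begin
    toℕ x + k                           ≡⟨ m≡m%n+[m/n]*n (toℕ x + k) (suc m) ⟩
    (toℕ x + k) % suc m + q * suc m     ≡⟨ cong (_+ q * suc m) (toℕ-iterate-next k x) ⟨
    toℕ (iterate next x k) + q * suc m  ≡⟨ cong (λ v → toℕ v + q * suc m) eq ⟩
    toℕ x + q * suc m                   ∎)

next-injective : {a b : Fin (suc m)} → next a ≡ next b → a ≡ b
next-injective {m} {a} {b} eq = begin
  a                        ≡⟨ iterate-next-period a ⟨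
  iterate next (next a) m  ≡⟨ cong (λ x → iterate next x m) eq ⟩
  iterate next (next b) m  ≡⟨ iterate-next-period b ⟩
  b                        ∎
  where open ≡-Reasoning

prev : Fin (suc m) → Fin (suc m)
prev {m} x = iterate next x m

next-prev : (x : Fin (suc m)) → next (prev x) ≡ x
next-prev {m} x = trans (sym (iterate-shift next x m)) (iterate-next-period x)

next≢id : (x : Fin (2 + m)) → next x ≢ x
next≢id x = iterate-next≢id {k = 1} x z<s (s<s z<s)

next²≢id : (x : Fin (3 + m)) → next (next x) ≢ x
next²≢id x = iterate-next≢id {k = 2} x z<s (s<s (s<s z<s))

next³≢id : (x : Fin (4 + m)) → next (next (next x)) ≢ x
next³≢id x = iterate-next≢id {k = 3} x z<s (s<s (s<s (s<s z<s)))

next⁴≢id : (x : Fin (5 + m)) → next (next (next (next x))) ≢ x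
next⁴≢id x = iterate-next≢id {k = 4} x z<s (s<s (s<s (s<s (s<s z<s))))

-- Edges and paths of length two

Joins : Fin n → Fin n → Fin n → Set
Joins f u v = (u ≡ f × v ≡ next f) ⊎ (u ≡ next f × v ≡ f)

Joins₂ : Fin n → Fin n → Fin n → Set
Joins₂ e x y = (x ≡ e × y ≡ next (next e)) ⊎ (x ≡ next (next e) × y ≡ e)

joins-sym : {f u v : Fin n} → Joins f u v → Joins f v u
joins-sym (inj₁ (p , q)) = inj₂ (q , p)
joins-sym (inj₂ (p , q)) = inj₁ (q , p)

joins-irrefl : {f u : Fin (2 + m)} → ¬ Joins f u u
joins-irrefl (inj₁ (refl , u≡next)) = next≢id _ (sym u≡next)
joins-irrefl (inj₂ (u≡next , refl)) = next≢id _ (sym u≡next)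

joins-unique : {f g u v : Fin (3 + m)} → Joins f u v → Joins g u v → f ≡ g
joins-unique (inj₁ (refl , refl)) (inj₁ (refl , _)) = refl
joins-unique (inj₁ (refl , refl)) (inj₂ (p , q))    =
  ⊥-elim (next²≢id _ (trans (cong next (sym p)) q))
joins-unique (inj₂ (refl , refl)) (inj₁ (p , q))    =
  ⊥-elim (next²≢id _ (trans (cong next p) (sym q)))
joins-unique (inj₂ (refl , refl)) (inj₂ (_ , refl)) = refl

joins-avoids : {g u v w : Fin n} → Joins g u v → g ≢ w → next g ≢ w → u ≢ w × v ≢ w
joins-avoids (inj₁ (refl , refl)) g≢w next≢w = g≢w , next≢w
joins-avoids (inj₂ (refl , refl)) g≢w next≢w = next≢w , g≢w

¬joins-next² : {e f : Fin (4 + m)} → ¬ Joins f e (next (next e))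
¬joins-next² {f = f} (inj₁ (refl , p)) = next≢id f (next-injective p)
¬joins-next² {f = f} (inj₂ (refl , p)) = next³≢id f p

joins-next² : {e f g z : Fin (5 + m)} →
              Joins f e z → Joins g z (next (next e)) → f ≡ e × g ≡ next e
joins-next² (inj₁ (refl , refl)) (inj₁ (refl , _)) = refl , refl
joins-next² {f = f} (inj₁ (refl , refl)) (inj₂ (p , refl)) =
  ⊥-elim (next²≢id f (sym (next-injective p)))
joins-next² {f = f} (inj₂ (refl , refl)) (inj₁ (refl , p)) = ⊥-elim (next²≢id f (next-injective p))
joins-next² {g = g} (inj₂ (refl , refl)) (inj₂ (refl , p)) = ⊥-elim (next⁴≢id g p)

joins₂-irrefl : {e x : Fin (3 + m)} → ¬ Joins₂ e x x
joins₂-irrefl (inj₁ (refl , p)) = next²≢id _ (sym p)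
joins₂-irrefl (inj₂ (refl , p)) = next²≢id _ p

joins₂-avoids-middle : {e x y : Fin (2 + m)} → Joins₂ e x y → x ≢ next e × y ≢ next e
joins₂-avoids-middle {e = e} (inj₁ (refl , refl)) =
  next≢id e ∘ sym , next≢id e ∘ next-injective
joins₂-avoids-middle {e = e} (inj₂ (refl , refl)) =
  next≢id e ∘ next-injective , next≢id e ∘ sym

joins₂⇒¬joins : {e f x y : Fin (4 + m)} → Joins₂ e x y → ¬ Joins f x y
joins₂⇒¬joins (inj₁ (refl , refl)) j = ¬joins-next² j
joins₂⇒¬joins (inj₂ (refl , refl)) j = ¬joins-next² (joins-sym j)

joins₂-edges : {e f g x y z : Fin (5 + m)} → Joins₂ e x y → Joins f x z → Joins g z y →
               (f ≡ e × g ≡ next e) ⊎ (f ≡ next e × g ≡ e)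
joins₂-edges (inj₁ (refl , refl)) jf jg = inj₁ (joins-next² jf jg)
joins₂-edges (inj₂ (refl , refl)) jf jg
  with g≡e , f≡next ← joins-next² (joins-sym jg) (joins-sym jf) = inj₂ (f≡next , g≡e)

edge-avoiding-0 : (v : Fin (3 + m)) → v ≢ fzero →
                  ∃[ e ] ((e ≢ fzero × next e ≢ fzero) × (v ≡ e ⊎ v ≡ next e))
edge-avoiding-0 v v≢0 with next v ≟ fzero
... | no next≢0  = v , (v≢0 , next≢0) , inj₁ refl
... | yes next≡0 =
  prev v , (prev≢0 , subst (_≢ fzero) (sym (next-prev v)) v≢0) , inj₂ (sym (next-prev v))
  where
  open ≡-Reasoning
  prev≢0 : prev v ≢ fzero
  prev≢0 prev≡0 = next²≢id fzero (begin
    next (next fzero)     ≡⟨ cong (next ∘ next) prev≡0 ⟨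
    next (next (prev v))  ≡⟨ cong next (next-prev v) ⟩
    next v                ≡⟨ next≡0 ⟩
    fzero                 ∎)

-- Walks and monitoring

arc-joins : (o : Orientation n) (f : Fin n) → Joins f (tail o f) (head o f)
arc-joins o f = by-direction (o f)
  where
  by-direction : (b : Bool) → Joins f (if b then f else next f) (if b then next f else f)
  by-direction true  = inj₁ (refl , refl)
  by-direction false = inj₂ (refl , refl)

tail≢head : (o : Orientation (2 + m)) (f : Fin (2 + m)) → tail o f ≢ head o f
tail≢head o f eq = joins-irrefl (subst (Joins f (tail o f)) (sym eq) (arc-joins o f))

arc-step : {o : Orientation n} {f y : Fin n} {b : Bool} → o f ≡ b →
           Walk o (if b then next f else f) y k → Walk o (if b then f else next f) y (suc k)
arc-step {o = o} {f} p w =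
  cons f (cong (λ b → if b then f else next f) p)
         (subst (λ v → Walk o v _ _) (cong (λ b → if b then next f else f) (sym p)) w)

same-direction-walk : (o : Orientation n) (e : Fin n) → o e ≡ o (next e) →
                      ∃[ x ] ∃[ y ] (Joins₂ e x y × Walk o x y 2)
same-direction-walk o e same = along (o e) refl (sym same)
  where
  along : ∀ b → o e ≡ b → o (next e) ≡ b → ∃[ x ] ∃[ y ] (Joins₂ e x y × Walk o x y 2)
  along true  p q = _ , _ , inj₁ (refl , refl) , arc-step p (arc-step q nil)
  along false p q = _ , _ , inj₂ (refl , refl) , arc-step q (arc-step p nil)

module _ {o : Orientation n} where

  walk-length-0 : {x y : Fin n} → Walk o x y 0 → x ≡ y
  walk-length-0 nil = refl

  walk-length-1 : {x y : Fin n} (w : Walk o x y 1) → ∃[ f ] (Joins f x y × OnWalk f w)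
  walk-length-1 (cons f p w) = f , subst₂ (Joins f) p (walk-length-0 w) (arc-joins o f) , here p w

  walk-length-2 : {x y : Fin n} (w : Walk o x y 2) →
                  ∃[ f ] ∃[ g ] ∃[ z ] (Joins f x z × Joins g z y × OnWalk f w × OnWalk g w)
  walk-length-2 (cons f p (cons g q w)) =
    f , g , head o f ,
    subst (λ u → Joins f u (head o f)) p (arc-joins o f) ,
    subst₂ (Joins g) q (walk-length-0 w) (arc-joins o g) ,
    here p _ , there f p _ (here q w)

  leaves-start : {e x y : Fin n} {w : Walk o x y k} → OnWalk e w → ∃[ f ] tail o f ≡ x
  leaves-start (here p _)      = _ , p
  leaves-start (there f p _ _) = f , p

arc-monitored : (o : Orientation (3 + m)) (e : Fin (3 + m)) →
                MonitorsDir o (tail o e) (head o e) e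
arc-monitored o e = 1 , (cons e refl nil , no-shorter) , through-e
  where
  no-shorter : ∀ j → j < 1 → ¬ Walk o (tail o e) (head o e) j
  no-shorter zero    _        w = tail≢head o e (walk-length-0 w)
  no-shorter (suc _) (s≤s ()) _
  through-e : (w : Walk o (tail o e) (head o e) 1) → OnWalk e w
  through-e w with f , f-joins , f∈w ← walk-length-1 w =
    subst (λ g → OnWalk g w) (joins-unique f-joins (arc-joins o e)) f∈w

monitorsDir-arc-ends : (o : Orientation (2 + m)) {e f : Fin (2 + m)} →
                       MonitorsDir o (tail o f) (head o f) e → e ≡ f
monitorsDir-arc-ends o {f = f} (zero , (w , _) , _) = ⊥-elim (tail≢head o f (walk-length-0 w))
monitorsDir-arc-ends o {f = f} (suc zero , _ , through) with through (cons f refl nil)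
... | here _ _ = refl
... | there _ _ _ ()
monitorsDir-arc-ends o {f = f} (suc (suc _) , (_ , shorter) , _) =
  ⊥-elim (shorter 1 (s<s z<s) (cons f refl nil))

joins₂-monitored : (o : Orientation (5 + m)) {e x y : Fin (5 + m)} →
                   Joins₂ e x y → Walk o x y 2 → MonitorsDir o x y e × MonitorsDir o x y (next e)
joins₂-monitored o {e} {x} {y} j w₂ =
  (2 , (w₂ , no-shorter) , proj₁ ∘ through) , (2 , (w₂ , no-shorter) , proj₂ ∘ through)
  where
  no-shorter : ∀ i → i < 2 → ¬ Walk o x y i
  no-shorter zero          _               w =
    joins₂-irrefl (subst (Joins₂ e x) (sym (walk-length-0 w)) j)
  no-shorter (suc zero)    _               w = joins₂⇒¬joins j (proj₁ (proj₂ (walk-length-1 w)))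
  no-shorter (suc (suc _)) (s≤s (s≤s ())) _
  through : (w : Walk o x y 2) → OnWalk e w × OnWalk (next e) w
  through w with f , g , _ , jf , jg , f∈w , g∈w ← walk-length-2 w | joins₂-edges j jf jg
  ... | inj₁ (refl , refl) = f∈w , g∈w
  ... | inj₂ (refl , refl) = g∈w , f∈w

-- Sources and sinks

IsSource IsSink : Orientation n → Fin n → Set
IsSource o v = ∀ f → head o f ≢ v
IsSink   o v = ∀ f → tail o f ≢ v

SourceToSink : Orientation n → Fin n → Set
SourceToSink o e = IsSource o (tail o e) × IsSink o (head o e)

module _ {o : Orientation n} where

  source-to-sink-walk : {e x y : Fin n} → SourceToSink o e → (w : Walk o x y k) → OnWalk e w →
                        x ≡ tail o e × y ≡ head o e
  source-to-sink-walk _          (cons _ p nil)          (here _ _)      = sym p , refl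
  source-to-sink-walk (_ , sink) (cons _ _ (cons f q _)) (here _ _)      = ⊥-elim (sink f q)
  source-to-sink-walk st         (cons f _ w)            (there _ _ _ e∈w) =
    ⊥-elim (proj₁ st f (proj₁ (source-to-sink-walk st w e∈w)))

  source-to-sink-ends-∈ : {e : Fin n} {M : Subset n} → SourceToSink o e → IsMAG o M →
                          tail o e ∈ M × head o e ∈ M
  source-to-sink-ends-∈ {e} st mag with mag e
  ... | _ , _ , x∈M , y∈M , _ , inj₁ (_ , (w , _) , through)
    with refl , refl ← source-to-sink-walk st w (through w) = x∈M , y∈M
  ... | _ , _ , x∈M , y∈M , _ , inj₂ (_ , (w , _) , through)
    with refl , refl ← source-to-sink-walk st w (through w) = y∈M , x∈M

  source-to-sink-edge-∈ : {e : Fin n} {M : Subset n} → SourceToSink o e → IsMAG o M →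
                          e ∈ M × next e ∈ M
  source-to-sink-edge-∈ {e} {M} st mag with source-to-sink-ends-∈ st mag | arc-joins o e
  ... | t∈M , h∈M | inj₁ (t≡e , h≡next) = subst (_∈ M) t≡e t∈M , subst (_∈ M) h≡next h∈M
  ... | t∈M , h∈M | inj₂ (t≡next , h≡e) = subst (_∈ M) h≡e h∈M , subst (_∈ M) t≡next t∈M

  sink-¬monitors : {e x y : Fin n} → IsSink o x → ¬ MonitorsDir o x y e
  sink-¬monitors sink (_ , (w , _) , through) with f , p ← leaves-start (through w) = sink f p

-- The alternating orientation

isEven : ℕ → Bool
isEven n = n % 2 ≡ᵇ 0

isEven-suc : ∀ n → isEven (suc n) ≡ not (isEven n)
isEven-suc zero          = refl
isEven-suc (suc zero)    = refl
isEven-suc (suc (suc n)) = isEven-suc n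

flips⇒odd-steps-flip : (o : Orientation n) → (∀ e → o (next e) ≡ not (o e)) →
                       ∀ k x → isEven k ≡ false → o (iterate next x k) ≡ not (o x)
flips⇒odd-steps-flip o flips (suc zero)    x _   = flips x
flips⇒odd-steps-flip o flips (suc (suc k)) x odd = begin
  o (iterate next (next (next x)) k)  ≡⟨ flips⇒odd-steps-flip o flips k (next (next x)) odd ⟩
  not (o (next (next x)))             ≡⟨ cong not (flips (next x)) ⟩
  not (not (o (next x)))              ≡⟨ not-involutive (o (next x)) ⟩
  o (next x)                          ≡⟨ flips x ⟩
  not (o x)                           ∎
  where open ≡-Reasoning

odd-cycle-same-direction : isEven (suc m) ≡ false → (o : Orientation (suc m)) →
                           ∃[ e ] o e ≡ o (next e)
odd-cycle-same-direction {m} odd o with any? (λ e → o e ≟ᵇ o (next e))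
... | yes found = found
... | no none = ⊥-elim (not-¬ refl (begin
  o fzero                         ≡⟨ cong o (iterate-next-period fzero) ⟨
  o (iterate next fzero (suc m))  ≡⟨ flips⇒odd-steps-flip o flips (suc m) fzero odd ⟩
  not (o fzero)                   ∎))
  where
  open ≡-Reasoning
  flips : ∀ e → o (next e) ≡ not (o e)
  flips e = ¬-not (λ eq → none (e , sym eq))

-- Even vertices are sources and odd ones sinks, except that for odd n both n-1 and 0 are even,
-- so the arcs n-1 → 0 → 1 pass through vertex 0.
alternating : Orientation n
alternating e = isEven (toℕ e)

alternating-tail-even : (f : Fin (suc m)) → isEven (toℕ (tail alternating f)) ≡ true
alternating-tail-even f = by-parity (isEven (toℕ f)) refl
  where
  by-parity : ∀ b → isEven (toℕ f) ≡ b → isEven (toℕ (if b then f else next f)) ≡ true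
  by-parity true  p = p
  by-parity false p with toℕ-next-cases f
  ... | inj₁ next≡suc     = trans (cong isEven next≡suc) (trans (isEven-suc (toℕ f)) (cong not p))
  ... | inj₂ (next≡0 , _) = cong isEven next≡0

alternating-head-even : (f : Fin (suc m)) → isEven (toℕ (head alternating f)) ≡ true →
                        head alternating f ≡ fzero × isEven (suc m) ≡ false
alternating-head-even {m} f = by-parity (isEven (toℕ f)) refl
  where
  by-parity : ∀ b → isEven (toℕ f) ≡ b → isEven (toℕ (if b then next f else f)) ≡ true →
              (if b then next f else f) ≡ fzero × isEven (suc m) ≡ false
  by-parity false p q = ⊥-elim (not-¬ q p)
  by-parity true  p q with toℕ-next-cases f
  ... | inj₁ next≡suc =
    ⊥-elim (not-¬ q (trans (cong isEven next≡suc) (trans (isEven-suc (toℕ f)) (cong not p))))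
  ... | inj₂ (next≡0 , f+1≡n) =
    toℕ-injective next≡0 , trans (cong isEven (sym f+1≡n)) (trans (isEven-suc (toℕ f)) (cong not p))

alternating-source-to-sink : (e : Fin (suc m)) →
                             isEven (suc m) ≡ true ⊎ (e ≢ fzero × next e ≢ fzero) →
                             SourceToSink alternating e
alternating-source-to-sink {m} e even-or-away = source , sink
  where
  ends-nonzero : isEven (suc m) ≡ false →
                 tail alternating e ≢ fzero × head alternating e ≢ fzero
  ends-nonzero odd = case even-or-away of λ where
    (inj₁ even)             → ⊥-elim (not-¬ even odd)
    (inj₂ (e≢0 , next≢0)) → joins-avoids (arc-joins alternating e) e≢0 next≢0
  source : IsSource alternating (tail alternating e)
  source f h≡t
    with h≡0 , odd ← alternating-head-even f
                       (trans (cong (isEven ∘ toℕ) h≡t) (alternating-tail-even e))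
    = proj₁ (ends-nonzero odd) (trans (sym h≡t) h≡0)
  sink : IsSink alternating (head alternating e)
  sink f t≡h
    with h≡0 , odd ← alternating-head-even e
                       (trans (cong (isEven ∘ toℕ) (sym t≡h)) (alternating-tail-even f))
    = proj₂ (ends-nonzero odd) h≡0

alternating-even-∈ : {M : Subset (suc m)} → isEven (suc m) ≡ true → IsMAG alternating M →
                     ∀ v → v ∈ M
alternating-even-∈ even mag v =
  proj₁ (source-to-sink-edge-∈ (alternating-source-to-sink v (inj₁ even)) mag)

alternating-nonzero-∈ : {M : Subset (3 + m)} → IsMAG alternating M → ∀ v → v ≢ fzero → v ∈ M
alternating-nonzero-∈ mag v v≢0 with e , away , v-end ← edge-avoiding-0 v v≢0
  with e∈M , next∈M ← source-to-sink-edge-∈ {e = e} (alternating-source-to-sink e (inj₂ away)) mag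
  with v-end
... | inj₁ refl = e∈M
... | inj₂ refl = next∈M

C₃-arc-0-¬monitored-by-1-2 : ¬ Monitors (alternating {3}) (fsuc fzero) (fsuc (fsuc fzero)) fzero
C₃-arc-0-¬monitored-by-1-2 (inj₁ from-1) =
  sink-¬monitors (proj₂ (alternating-source-to-sink (fsuc fzero) (inj₂ ((λ ()) , (λ ()))))) from-1
C₃-arc-0-¬monitored-by-1-2 (inj₂ from-2)
  with () ← monitorsDir-arc-ends alternating {f = fsuc fzero} from-2

C₃-alternating-∈ : {M : Subset 3} → IsMAG alternating M → ∀ v → v ∈ M
C₃-alternating-∈ mag v@(fsuc _) = alternating-nonzero-∈ mag v (λ ())
C₃-alternating-∈ mag fzero with mag fzero
... | fzero , _ , x∈M , _ = x∈M
... | _ , fzero , _ , y∈M , _ = y∈M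
... | fsuc fzero , fsuc fzero , _ , _ , x≢y , _ = ⊥-elim (x≢y refl)
... | fsuc (fsuc fzero) , fsuc (fsuc fzero) , _ , _ , x≢y , _ = ⊥-elim (x≢y refl)
... | fsuc fzero , fsuc (fsuc fzero) , _ , _ , _ , mon = ⊥-elim (C₃-arc-0-¬monitored-by-1-2 mon)
... | fsuc (fsuc fzero) , fsuc fzero , _ , _ , _ , mon =
  ⊥-elim (C₃-arc-0-¬monitored-by-1-2 (swap mon))

-- The directed cycle

directed : Orientation n
directed _ = true

directed-walk : ∀ k (x : Fin n) → Walk directed x (iterate next x k) k
directed-walk zero    x = nil
directed-walk (suc k) x = cons x refl (directed-walk k (next x))

directed-walk-end : {x y : Fin n} → Walk directed x y k → y ≡ iterate next x k
directed-walk-end nil             = refl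
directed-walk-end (cons _ refl w) = directed-walk-end w

directed-walk-visits : {x y : Fin n} (w : Walk directed x y k) → ∀ i → i < k →
                       OnWalk (iterate next x i) w
directed-walk-visits (cons _ refl w) zero    _         = here refl w
directed-walk-visits (cons f refl w) (suc i) (s<s i<k) =
  there f refl w (directed-walk-visits w i i<k)

directed-monitored-from-1 : (e : Fin (suc m)) →
                            MonitorsDir (directed {2 + m}) (fsuc fzero) fzero (fsuc e)
directed-monitored-from-1 {m} e = suc m , (around , no-shorter) , through
  where
  around : Walk directed (fsuc fzero) fzero (suc m)
  around = subst (λ y → Walk directed (fsuc fzero) y (suc m)) (iterate-next-period fzero)
                 (directed-walk (suc m) (fsuc fzero))
  no-shorter : ∀ j → j < suc m → ¬ Walk directed (fsuc fzero) fzero j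
  no-shorter j j<m w = iterate-next≢id fzero z<s (s<s j<m) (sym (directed-walk-end w))
  through : (w : Walk directed (fsuc fzero) fzero (suc m)) → OnWalk (fsuc e) w
  through w = subst (λ a → OnWalk a w) (iterate-next-from-0 (fsuc e))
                    (directed-walk-visits w (toℕ e) (toℕ<n e))

⁅0,1⁆ : Subset (2 + m)
⁅0,1⁆ = inside ∷ inside ∷ ⊥

directed-isMAG : IsMAG (directed {3 + m}) ⁅0,1⁆
directed-isMAG fzero    =
  fzero , fsuc fzero , here , there here , (λ ()) , inj₁ (arc-monitored directed fzero)
directed-isMAG (fsuc e) =
  fzero , fsuc fzero , here , there here , (λ ()) , inj₂ (directed-monitored-from-1 e)

x∈p⇒0<∣p∣ : {x : Fin n} {p : Subset n} → x ∈ p → 0 < ∣ p ∣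
x∈p⇒0<∣p∣ {x = x} {p} x∈p = subst (_≤ ∣ p ∣) (∣⁅x⁆∣≡1 x)
  (p⊆q⇒∣p∣≤∣q∣ (λ y∈⁅x⁆ → subst (_∈ p) (sym (x∈⁅y⁆⇒x≡y x y∈⁅x⁆)) x∈p))

x∈p∧y∈p∧x≢y⇒2≤∣p∣ : {x y : Fin n} {p : Subset n} → x ∈ p → y ∈ p → x ≢ y → 2 ≤ ∣ p ∣
x∈p∧y∈p∧x≢y⇒2≤∣p∣ x∈p y∈p x≢y =
  ≤-trans (s≤s (x∈p⇒0<∣p∣ (x∈p∧x≢y⇒x∈p-y y∈p (x≢y ∘ sym)))) (x∈p⇒∣p-x∣<∣p∣ x∈p)

all∈⇒n≤∣p∣ : {p : Subset n} → (∀ x → x ∈ p) → n ≤ ∣ p ∣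
all∈⇒n≤∣p∣ {n} {p} all∈ = subst (_≤ ∣ p ∣) (∣⊤∣≡n n) (p⊆q⇒∣p∣≤∣q∣ {p = ⊤} (λ {x} _ → all∈ x))

∣∁⁅x⁆∣≡n∸1 : (x : Fin n) → ∣ ∁ ⁅ x ⁆ ∣ ≡ n ∸ 1
∣∁⁅x⁆∣≡n∸1 {n} x = trans (∣∁p∣≡n∸∣p∣ ⁅ x ⁆) (cong (n ∸_) (∣⁅x⁆∣≡1 x))

x≢y⇒x∈∁⁅y⁆ : {x y : Fin n} → x ≢ y → x ∈ ∁ ⁅ y ⁆
x≢y⇒x∈∁⁅y⁆ = x∉p⇒x∈∁p ∘ x≢y⇒x∉⁅y⁆

all∈∁⁅y⁆⇒n∸1≤∣p∣ : {p : Subset n} (y : Fin n) → (∀ x → x ≢ y → x ∈ p) → n ∸ 1 ≤ ∣ p ∣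
all∈∁⁅y⁆⇒n∸1≤∣p∣ {p = p} y all∈ = subst (_≤ ∣ p ∣) (∣∁⁅x⁆∣≡n∸1 y)
  (p⊆q⇒∣p∣≤∣q∣ (λ {x} x∈∁ → all∈ x (x∉⁅y⁆⇒x≢y (x∈∁p⇒x∉p x∈∁))))

MagAtMost MagAtLeast : Orientation n → ℕ → Set
MagAtMost  {n} o k = ∃[ M ] (IsMAG o M × ∣ M ∣ ≤ k)
MagAtLeast {n} o k = (M : Subset n) → IsMAG o M → k ≤ ∣ M ∣

magMinus-intro : (o : Orientation n) → MagAtMost o k → (∀ o → MagAtLeast o k) → MagMinus n k
magMinus-intro o (M , mag , ∣M∣≤k) lower =
  (o , (M , mag , ≤-antisym ∣M∣≤k (lower o M mag)) , lower o) ,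
  λ o′ _ ((M′ , mag′ , ∣M′∣≡k′) , _) → subst (_ ≤_) ∣M′∣≡k′ (lower o′ M′ mag′)

magPlus-intro : (o : Orientation n) → MagAtLeast o k → (∀ o → MagAtMost o k) → MagPlus n k
magPlus-intro {n} {k} o lower upper with M , mag , ∣M∣≤k ← upper o =
  (o , (M , mag , ≤-antisym ∣M∣≤k (lower M mag)) , lower) , bounded
  where
  bounded : ∀ o′ k′ → IsMag o′ k′ → k′ ≤ k
  bounded o′ _ (_ , minimal) with M′ , mag′ , ∣M′∣≤k ← upper o′ = ≤-trans (minimal M′ mag′) ∣M′∣≤k

mag≥2 : (o : Orientation (suc m)) → MagAtLeast o 2
mag≥2 o M mag with _ , _ , x∈M , y∈M , x≢y , _ ← mag fzero = x∈p∧y∈p∧x≢y⇒2≤∣p∣ x∈M y∈M x≢y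

⊤-isMAG : (o : Orientation (3 + m)) → IsMAG o ⊤
⊤-isMAG o e = tail o e , head o e , ∈⊤ , ∈⊤ , tail≢head o e , inj₁ (arc-monitored o e)

mag≤n : (o : Orientation (3 + m)) → MagAtMost o (3 + m)
mag≤n {m} o = ⊤ , ⊤-isMAG o , ≤-reflexive (∣⊤∣≡n (3 + m))

same-direction-monitored : (o : Orientation (5 + m)) {e g : Fin (5 + m)} → o e ≡ o (next e) →
                           g ≡ e ⊎ g ≡ next e →
                           ∃[ x ] ∃[ y ] (x ∈ ∁ ⁅ next e ⁆ × y ∈ ∁ ⁅ next e ⁆ × x ≢ y ×
                                          Monitors o x y g)
same-direction-monitored o {e} same g-on-path with x , y , j , w ← same-direction-walk o e same =
  let x≢next , y≢next = joins₂-avoids-middle j in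
  x , y , x≢y⇒x∈∁⁅y⁆ x≢next , x≢y⇒x∈∁⁅y⁆ y≢next ,
  (λ x≡y → joins₂-irrefl (subst (Joins₂ e x) (sym x≡y) j)) , inj₁ (monitored g-on-path)
  where
  monitored : ∀ {g} → g ≡ e ⊎ g ≡ next e → MonitorsDir o x y g
  monitored (inj₁ refl) = proj₁ (joins₂-monitored o j w)
  monitored (inj₂ refl) = proj₂ (joins₂-monitored o j w)

∁⁅next⁆-isMAG : (o : Orientation (5 + m)) (e : Fin (5 + m)) → o e ≡ o (next e) →
                IsMAG o (∁ ⁅ next e ⁆)
∁⁅next⁆-isMAG o e same g with g ≟ e | g ≟ next e
... | yes g≡e | _          = same-direction-monitored o same (inj₁ g≡e)
... | no _    | yes g≡next = same-direction-monitored o same (inj₂ g≡next)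
... | no g≢e  | no g≢next  =
  let t≢next , h≢next = joins-avoids (arc-joins o g) g≢next (g≢e ∘ next-injective) in
  tail o g , head o g , x≢y⇒x∈∁⁅y⁆ t≢next , x≢y⇒x∈∁⁅y⁆ h≢next , tail≢head o g ,
  inj₁ (arc-monitored o g)

odd-mag≤n∸1 : isEven (5 + m) ≡ false → (o : Orientation (5 + m)) → MagAtMost o (4 + m)
odd-mag≤n∸1 odd o with e , same ← odd-cycle-same-direction odd o =
  ∁ ⁅ next e ⁆ , ∁⁅next⁆-isMAG o e same , ≤-reflexive (∣∁⁅x⁆∣≡n∸1 (next e))

mag⁻-cycle : (n : ℕ) → 3 ≤ n → MagMinus n 2
mag⁻-cycle _ (s≤s (s≤s (s≤s {n = m} _))) =
  magMinus-intro directed (⁅0,1⁆ , directed-isMAG , ≤-reflexive ∣⁅0,1⁆∣≡2) mag≥2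
  where
  ∣⁅0,1⁆∣≡2 : ∣ ⁅0,1⁆ {suc m} ∣ ≡ 2
  ∣⁅0,1⁆∣≡2 = cong (2 +_) (∣⊥∣≡0 (suc m))

mag⁺-C₃ : MagPlus 3 3
mag⁺-C₃ = magPlus-intro alternating (λ _ → all∈⇒n≤∣p∣ ∘ C₃-alternating-∈) mag≤n

mag⁺-even : (n : ℕ) → 3 ≤ n → n % 2 ≡ 0 → MagPlus n n
mag⁺-even _ (s≤s (s≤s (s≤s _))) n-even =
  magPlus-intro alternating (λ _ → all∈⇒n≤∣p∣ ∘ alternating-even-∈ (cong (_≡ᵇ 0) n-even)) mag≤n

mag⁺-odd : (n : ℕ) → 4 ≤ n → n % 2 ≡ 1 → MagPlus n (n ∸ 1)
mag⁺-odd _ (s≤s (s≤s (s≤s (s≤s {n = zero} _))))  ()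
mag⁺-odd _ (s≤s (s≤s (s≤s (s≤s {n = suc _} _)))) n-odd =
  magPlus-intro alternating (λ _ mag → all∈∁⁅y⁆⇒n∸1≤∣p∣ fzero (alternating-nonzero-∈ mag))
                (odd-mag≤n∸1 (cong (_≡ᵇ 0) n-odd))

corollary3 : ((n : ℕ) → 3 ≤ n → MagMinus n 2)
    × MagPlus 3 3
    × ((n : ℕ) → 4 ≤ n →
        (n % 2 ≡ 1 → MagPlus n (n ∸ 1)) × (n % 2 ≡ 0 → MagPlus n n))
corollary3 =
  mag⁻-cycle , mag⁺-C₃ , λ n 4≤n → mag⁺-odd n 4≤n , mag⁺-even n (≤-trans (n≤1+n 3) 4≤n)
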